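{- Let $\sigma$ be a signature, $\mathfrak M$ a descriptive $\sigma$-model based on a weakly transitive frame $(W,R)$, $\varrho\subseteq\sigma$, $C$ a cluster in $\mathfrak M$, and $\Gamma$ a set of $\sigma$-formulas. Then: (a) $|C|\le 2^{|\sigma|}$; (b) if $x\in W$ and $\mathfrak M,x\models\Diamond\bigwedge\Gamma'$ for every finite $\Gamma'\subseteq\Gamma$, then there is $y$ with $xRy$ and $\mathfrak M,y\models\Gamma$ (i.e. $y$ satisfies every formula of $\Gamma$); (c) there exists a $\varrho$-maximal cluster $C'$ such that $C R^r C'$ and $t^\varrho_{\mathfrak M}(C)\subseteq t^\varrho_{\mathfrak M}(C')$.
   Context: A signature is a finite set of propositional variables; $\sigma$-formulas are built from variables in $\sigma$, $\bot,\top$, $\land,\neg,\Diamond$ ($\Box=\neg\Diamond\neg$). A frame $(W,R)$ is weakly transitive if $xRyRz$ implies $x=z$ or $xRz$. A $\sigma$-model is such a frame with a valuation of $\sigma$. For $\varrho\subseteq\sigma$, $t^\varrho_{\mathfrak M}(x)$ is the set of $\varrho$-formulas true at $x$, and for $X\subseteq W$, $t^\varrho_{\mathfrak M}(X)=\{t^\varrho_{\mathfrak M}(x)\mid x\in X\}$. $\mathfrak M$ is descriptive if for all $x,y\in W$ and sets $\Gamma$ of $\sigma$-formulas: (dif) $x=y$ iff $t^\sigma_{\mathfrak M}(x)=t^\sigma_{\mathfrak M}(y)$; (ref) $xRy$ iff $\{\Diamond\chi\mid\chi\in t^\sigma_{\mathfrak M}(y)\}\subseteq t^\sigma_{\mathfrak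 M}(x)$ iff $\{\chi\mid\Box\chi\in t^\sigma_{\mathfrak M}(x)\}\subseteq t^\sigma_{\mathfrak M}(y)$; (com) if every finite subset of $\Gamma$ is true at some point, then $\Gamma$ is true at some point. A cluster is a set $C(x)=\{x\}\cup\{y\mid xRy\land yRx\}$. For clusters $C,C'$, $CRC'$ means $xRy$ for some $x\in C$, $y\in C'$; $CR^rC'$ means $C=C'$ or ($CRC'$ and $C\neq C'$); $CRy$ means $xRy$ for some $x\in C$. A cluster $C$ is $\varrho$-maximal if for any $x\in C$ and $y\in W$, whenever $CRy$ and $t^\varrho_{\mathfrak M}(x)=t^\varrho_{\mathfrak M}(y)$, then $y\in C$. -}

module Defs where

open import Level using (Level; 0ℓ) renaming (suc to lsuc)
open import Data.Nat using (ℕ; _^_)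
open import Data.Fin using (Fin)
open import Data.Fin.Subset using (Subset; _∈_)
open import Data.List using (List; []; _∷_; foldr)
open import Data.List.Relation.Unary.All using (All)
open import Data.Product using (Σ; ∃; _×_; _,_; proj₁)
open import Data.Sum using (_⊎_)
open import Data.Empty using (⊥)
open import Data.Unit using (⊤)
open import Relation.Nullary using (¬_)
open import Relation.Unary using (Pred; _⊆_; _≐_)
open import Relation.Binary.PropositionalEquality using (_≡_)
open import Function.Bundles using (_⇔_)
open import Function.Definitions using (Injective)
import Data.List.Membership.Propositional

-- A signature σ with |σ| = n is modelled as the variables Fin n.
-- σ-formulas: built from variables, ⊥, ⊤, ∧, ¬, ◇.
data Formula (n : ℕ) : Set where
  var  : Fin n → Formula n
  ⊥'   : Formula n
  ⊤'   : Formula n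
  _∧'_ : Formula n → Formula n → Formula n
  ¬'_  : Formula n → Formula n
  ◇_   : Formula n → Formula n

infixr 6 _∧'_
infix 7 ¬'_ ◇_ □_

□_ : ∀ {n} → Formula n → Formula n
□ φ = ¬' (◇ (¬' φ))

⋀ : ∀ {n} → List (Formula n) → Formula n
⋀ = foldr _∧'_ ⊤'

Over : ∀ {n} → Subset n → Formula n → Set
Over ϱ (var p)  = p ∈ ϱ
Over ϱ ⊥'       = ⊤
Over ϱ ⊤'       = ⊤
Over ϱ (φ ∧' ψ) = Over ϱ φ × Over ϱ ψ
Over ϱ (¬' φ)   = Over ϱ φ
Over ϱ (◇ φ)    = Over ϱ φ

record Model (n : ℕ) : Set₁ where
  field
    W : Set
    R : W → W → Set
    V : Fin n → W → Set

module _ {n : ℕ} (M : Model n) where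
  open Model M

  infix 4 _⊨_
  _⊨_ : W → Formula n → Set
  x ⊨ var p    = V p x
  x ⊨ ⊥'       = ⊥
  x ⊨ ⊤'       = ⊤
  x ⊨ (φ ∧' ψ) = (x ⊨ φ) × (x ⊨ ψ)
  x ⊨ (¬' φ)   = ¬ (x ⊨ φ)
  x ⊨ (◇ φ)    = ∃ λ y → R x y × (y ⊨ φ)

  WeaklyTransitive : Set
  WeaklyTransitive = ∀ x y z → R x y → R y z → x ≡ z ⊎ R x z

  t : Subset n → W → Pred (Formula n) 0ℓ
  t ϱ x φ = Over ϱ φ × (x ⊨ φ)

  tσ : W → Pred (Formula n) 0ℓ
  tσ = t Data.Fin.Subset.⊤

  TrueSet : Pred (Formula n) 0ℓ → W → Set
  TrueSet Γ x = ∀ φ → Γ φ → x ⊨ φ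

  FiniteSubset : Pred (Formula n) 0ℓ → List (Formula n) → Set
  FiniteSubset Γ Δ = All Γ Δ

  record Descriptive : Set₁ where
    field
      dif  : ∀ x y → (x ≡ y) ⇔ (tσ x ≐ tσ y)
      ref₁ : ∀ x y → R x y ⇔ (∀ χ → tσ y χ → tσ x (◇ χ))
      ref₂ : ∀ x y → R x y ⇔ (∀ χ → tσ x (□ χ) → tσ y χ)
      com  : ∀ (Γ : Pred (Formula n) 0ℓ) →
             (∀ Δ → FiniteSubset Γ Δ → ∃ λ x → ∀ φ → φ Data.List.Membership.Propositional.∈ Δ → x ⊨ φ) →
             ∃ λ x → TrueSet Γ x

  -- the cluster C(x) = {x} ∪ {y | xRy ∧ yRx}; clusters are represented by a point
  Cl : W → Pred W 0ℓ
  Cl x y = x ≡ y ⊎ (R x y × R y x)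

  SameCluster : W → W → Set
  SameCluster x x′ = Cl x ≐ Cl x′

  ClR : W → W → Set
  ClR x x′ = ∃ λ u → ∃ λ v → Cl x u × Cl x′ v × R u v

  ClRr : W → W → Set
  ClRr x x′ = SameCluster x x′ ⊎ (ClR x x′ × ¬ SameCluster x x′)

  ClRpt : W → W → Set
  ClRpt x y = ∃ λ u → Cl x u × R u y

  Maximal : Subset n → W → Set
  Maximal ϱ x = ∀ z y → Cl x z → ClRpt x y → t ϱ z ≐ t ϱ y → Cl x y

  TypesIncl : Subset n → W → W → Set
  TypesIncl ϱ x x′ = ∀ u → Cl x u → ∃ λ v → Cl x′ v × (t ϱ u ≐ t ϱ v)

  CardBound : W → Set
  CardBound x = ∃ λ (f : Σ W (Cl x) → Fin (2 ^ n)) →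
                  Injective (λ a b → proj₁ a ≡ proj₁ b) _≡_ f

{-# OPTIONS --safe #-}
-- (a) Two points of a cluster with the same valuation satisfy the same formulas (in the ◇ case
-- weak transitivity lets one point reach the other's successors), so by (dif) a point of a cluster
-- is determined by its valuation, a word of n bits.
-- (b) Γ together with the □-theory of x is finitely satisfiable, so (com) gives a point satisfying
-- both, and (ref) turns the □-theory inclusion into an R-edge from x.
-- (c) Call a point above c with the ϱ-type of c a twin. Going through an enumeration of all
-- formulas, a Lindenbaum construction yields a maximal set L of formulas such that every finite
-- part of □L holds at some twin. By (com) some twin z₀ satisfies □L; such candidates have □-theory
-- exactly L, hence by (ref) they all have the same successors. A candidate seen by z₀, or z₀ itself
-- if it sees none, then has no strict successor of its ϱ-type outside its cluster, and the
-- back-and-forth property of ϱ-types, a consequence of (b), spreads this to its whole cluster.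
module Submission where

open import Defs
open import Level using (Level; 0ℓ)
open import Data.Nat using (ℕ; zero; suc; _≤_; _≤′_; ≤′-refl; ≤′-step; _⊔_)
open import Data.Nat.Properties using (≤⇒≤′; m≤m⊔n; m≤n⊔m)
open import Data.Fin using (Fin; funToFin; finToFun) renaming (zero to fzero; suc to fsuc)
open import Data.Fin.Properties using (finToFun-funToFin)
open import Data.Fin.Subset using (Subset)
import Data.Fin.Subset as Subset
open import Data.Fin.Subset.Properties using (∈⊤)
open import Data.List using (List; []; _∷_; map; _++_; foldl; cartesianProductWith; allFin)
open import Data.List.Relation.Unary.All using (All; []; _∷_)
import Data.List.Relation.Unary.All as All
open import Data.List.Relation.Unary.Any using (here; there)
open import Data.List.Membership.Propositional using (_∈_)
open import Data.List.Membership.Propositional.Properties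
  using (∈-map⁺; ∈-++⁺ˡ; ∈-++⁺ʳ; ∈-cartesianProductWith⁺; ∈-allFin)
open import Data.Product using (∃; ∃-syntax; _×_; _,_; proj₁; proj₂)
open import Data.Sum using (_⊎_; inj₁; inj₂; [_,_])
open import Data.Empty using (⊥-elim)
open import Data.Unit using (tt)
open import Function using (_∘_; id)
open import Function.Bundles using (Equivalence)
open import Relation.Nullary using (¬_; Dec; yes; no; contradiction)
open import Relation.Unary using (Pred; _⊆_; _≐_; _∪_)
open import Relation.Unary.Properties using (≐-refl; ≐-sym; ≐-trans)
open import Relation.Binary.PropositionalEquality using (_≡_; _≗_; refl; sym; trans; cong)
open import Axiom.ExcludedMiddle using (ExcludedMiddle)
open import Axiom.DoubleNegationElimination using (em⇒dne)

Increasing : {A : Set} → (ℕ → Pred A 0ℓ) → Set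
Increasing Q = ∀ k → Q k ⊆ Q (suc k)

module _ {A : Set} {Q : ℕ → Pred A 0ℓ} (increasing : Increasing Q) where

  increasing-≤ : ∀ {k K} → k ≤ K → Q k ⊆ Q K
  increasing-≤ = go ∘ ≤⇒≤′
    where
    go : ∀ {k K} → k ≤′ K → Q k ⊆ Q K
    go ≤′-refl         qa = qa
    go (≤′-step k≤′K) qa = increasing _ (go k≤′K qa)

  All-bounded : ∀ {Δ} → All (λ a → ∃[ k ] Q k a) Δ → ∃[ K ] All (Q K) Δ
  All-bounded []               = 0 , []
  All-bounded ((k , qa) ∷ qas) =
    let K , qasK = All-bounded qas
    in k ⊔ K , increasing-≤ (m≤m⊔n k K) qa ∷ All.map (increasing-≤ (m≤n⊔m k K)) qasK

partition-All : {A : Set} {P Q : Pred A 0ℓ} {Δ : List A} → All (P ∪ Q) Δ →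
                ∃[ Δ₁ ] All P Δ₁ × (∀ {a} → a ∈ Δ → a ∈ Δ₁ ⊎ Q a)
partition-All []             = [] , [] , λ ()
partition-All (inj₁ pa ∷ as) =
  let Δ₁ , ps , split = partition-All as
  in _ ∷ Δ₁ , pa ∷ ps , λ { (here refl) → inj₁ (here refl)
                          ; (there a∈) → [ inj₁ ∘ there , inj₂ ] (split a∈) }
partition-All (inj₂ qa ∷ as) =
  let Δ₁ , ps , split = partition-All as
  in Δ₁ , ps , λ { (here refl) → inj₂ qa ; (there a∈) → split a∈ }

funToFin-injective : ∀ {m k} {f g : Fin m → Fin k} → funToFin f ≡ funToFin g → f ≗ g
funToFin-injective {f = f} {g} eq i =
  trans (sym (finToFun-funToFin f i)) (trans (cong (λ j → finToFun j i) eq) (finToFun-funToFin g i))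

bit : {P : Set} → Dec P → Fin 2
bit (yes _) = fsuc fzero
bit (no _)  = fzero

bit-≡⇒ : ∀ {P Q : Set} (p? : Dec P) (q? : Dec Q) → bit p? ≡ bit q? → P → Q
bit-≡⇒ (yes _) (yes q) _ _ = q
bit-≡⇒ (no ¬p) _       _ p = contradiction p ¬p

formulas : ∀ {n} → ℕ → List (Formula n)
formulas zero    = ⊥' ∷ ⊤' ∷ map var (allFin _)
formulas (suc k) =
  formulas k ++ map ¬'_ (formulas k) ++ map ◇_ (formulas k)
    ++ cartesianProductWith _∧'_ (formulas k) (formulas k)

formulas-increasing : ∀ {n} → Increasing (λ k (φ : Formula n) → φ ∈ formulas k)
formulas-increasing k = ∈-++⁺ˡ

formulas-complete : ∀ {n} (φ : Formula n) → ∃[ k ] φ ∈ formulas k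
formulas-complete (var p) = 0 , there (there (∈-map⁺ var (∈-allFin p)))
formulas-complete ⊥'      = 0 , here refl
formulas-complete ⊤'      = 0 , there (here refl)
formulas-complete (¬' φ)  =
  let k , φ∈ = formulas-complete φ
  in suc k , ∈-++⁺ʳ (formulas k) (∈-++⁺ˡ (∈-map⁺ ¬'_ φ∈))
formulas-complete (◇ φ)   =
  let k , φ∈ = formulas-complete φ
  in suc k , ∈-++⁺ʳ (formulas k) (∈-++⁺ʳ (map ¬'_ (formulas k)) (∈-++⁺ˡ (∈-map⁺ ◇_ φ∈)))
formulas-complete (φ ∧' ψ) =
  let i , φ∈ = formulas-complete φ
      j , ψ∈ = formulas-complete ψ
      fs = formulas (i ⊔ j)
  in suc (i ⊔ j) , ∈-++⁺ʳ fs (∈-++⁺ʳ (map ¬'_ fs) (∈-++⁺ʳ (map ◇_ fs)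
       (∈-cartesianProductWith⁺ _∧'_
         (increasing-≤ formulas-increasing (m≤m⊔n i j) φ∈)
         (increasing-≤ formulas-increasing (m≤n⊔m i j) ψ∈))))

Over-⊤ : ∀ {n} (φ : Formula n) → Over Subset.⊤ φ
Over-⊤ (var p)  = ∈⊤ {x = p}
Over-⊤ ⊥'       = tt
Over-⊤ ⊤'       = tt
Over-⊤ (φ ∧' ψ) = Over-⊤ φ , Over-⊤ ψ
Over-⊤ (¬' φ)   = Over-⊤ φ
Over-⊤ (◇ φ)    = Over-⊤ φ

Over-⋀ : ∀ {n} {ϱ : Subset n} {Δ} → All (Over ϱ) Δ → Over ϱ (⋀ Δ)
Over-⋀ []       = tt
Over-⋀ (o ∷ os) = o , Over-⋀ os

module Lindenbaum (lem : ExcludedMiddle 0ℓ) {A : Set} (P : List A → Set) (enum : ℕ → List A) where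

  extend : List A → A → List A
  extend Δ χ with lem {P (χ ∷ Δ)}
  ... | yes _ = χ ∷ Δ
  ... | no  _ = Δ

  extend-⊇ : ∀ {Δ χ ψ} → ψ ∈ Δ → ψ ∈ extend Δ χ
  extend-⊇ {Δ} {χ} ψ∈Δ with lem {P (χ ∷ Δ)}
  ... | yes _ = there ψ∈Δ
  ... | no  _ = ψ∈Δ

  extend-P : ∀ {Δ χ} → P Δ → P (extend Δ χ)
  extend-P {Δ} {χ} pΔ with lem {P (χ ∷ Δ)}
  ... | yes pχΔ = pχΔ
  ... | no  _   = pΔ

  extends-⊇ : ∀ {Δ ψ} L → ψ ∈ Δ → ψ ∈ foldl extend Δ L
  extends-⊇ []      ψ∈Δ = ψ∈Δ
  extends-⊇ (χ ∷ L) ψ∈Δ = extends-⊇ L (extend-⊇ ψ∈Δ)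

  extends-P : ∀ {Δ} L → P Δ → P (foldl extend Δ L)
  extends-P []      pΔ = pΔ
  extends-P (χ ∷ L) pΔ = extends-P L (extend-P pΔ)

  extends-complete : ∀ {Δ χ} L → χ ∈ L →
    (∀ Δ′ → (∀ {ψ} → ψ ∈ Δ′ → ψ ∈ foldl extend Δ L) → P (χ ∷ Δ′)) →
    χ ∈ foldl extend Δ L
  extends-complete {Δ} (χ ∷ L) (here refl) consistent with lem {P (χ ∷ Δ)}
  ... | yes _  = extends-⊇ L (here refl)
  ... | no ¬pχΔ = contradiction (consistent Δ (extends-⊇ L)) ¬pχΔ
  extends-complete (ψ ∷ L) (there χ∈L) consistent = extends-complete L χ∈L consistent

  stage : ℕ → List A
  stage zero    = []
  stage (suc k) = foldl extend (stage k) (enum k)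

  stage-increasing : Increasing (λ k χ → χ ∈ stage k)
  stage-increasing k = extends-⊇ (enum k)

  stage-P : P [] → ∀ k → P (stage k)
  stage-P p[] zero    = p[]
  stage-P p[] (suc k) = extends-P (enum k) (stage-P p[] k)

  Limit : Pred A 0ℓ
  Limit χ = ∃[ k ] χ ∈ stage k

  Limit-maximal : (∀ χ → ∃[ k ] χ ∈ enum k) →
    ∀ χ → (∀ Δ → (∀ {ψ} → ψ ∈ Δ → Limit ψ) → P (χ ∷ Δ)) → Limit χ
  Limit-maximal enumerates χ consistent =
    let k , χ∈ = enumerates χ
    in suc k , extends-complete (enum k) χ∈ (λ Δ Δ⊆ → consistent Δ (λ ψ∈ → suc k , Δ⊆ ψ∈))

module WeaklyTransitiveModel {n : ℕ} (M : Model n) (wt : WeaklyTransitive M) where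
  open Model M

  infix 4 _⊩_
  _⊩_ : W → Formula n → Set
  _⊩_ = _⊨_ M

  All-⋀ : ∀ {x Δ} → All (x ⊩_) Δ → x ⊩ ⋀ Δ
  All-⋀ []       = tt
  All-⋀ (s ∷ ss) = s , All-⋀ ss

  ⋀-All : ∀ {x} Δ → x ⊩ ⋀ Δ → All (x ⊩_) Δ
  ⋀-All []      tt       = []
  ⋀-All (φ ∷ Δ) (s , ss) = s ∷ ⋀-All Δ ss

  Cl-euclidean : ∀ {c x y} → Cl M c x → Cl M c y → Cl M x y
  Cl-euclidean (inj₁ refl)        cy                 = cy
  Cl-euclidean (inj₂ (cRx , xRc)) (inj₁ refl)        = inj₂ (xRc , cRx)
  Cl-euclidean (inj₂ (cRx , xRc)) (inj₂ (cRy , yRc)) with wt _ _ _ xRc cRy | wt _ _ _ yRc cRx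
  ... | inj₁ x≡y | _        = inj₁ x≡y
  ... | inj₂ _   | inj₁ y≡x = inj₁ (sym y≡x)
  ... | inj₂ xRy | inj₂ yRx = inj₂ (xRy , yRx)

  R-from-cluster : ∀ {z v y} → Cl M z v → R v y → Cl M z y ⊎ R z y
  R-from-cluster (inj₁ refl) vRy = inj₂ vRy
  R-from-cluster (inj₂ (zRv , _)) vRy with wt _ _ _ zRv vRy
  ... | inj₁ z≡y = inj₁ (inj₁ z≡y)
  ... | inj₂ zRy = inj₂ zRy

  Cl-between : ∀ {z y w} → R z y → R y w → (R z w → Cl M z w) → Cl M z y
  Cl-between zRy yRw close with wt _ _ _ zRy yRw
  ... | inj₁ refl = inj₂ (zRy , yRw)
  ... | inj₂ zRw with close zRw
  ...   | inj₁ refl        = inj₂ (zRy , yRw)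
  ...   | inj₂ (_ , wRz) with wt _ _ _ yRw wRz
  ...     | inj₁ refl = inj₁ refl
  ...     | inj₂ yRz  = inj₂ (zRy , yRz)

  trans-strictˡ : ∀ {x y z} → R x y → R y z → ¬ Cl M x y → R x z
  trans-strictˡ xRy yRz ¬xy with wt _ _ _ xRy yRz
  ... | inj₁ refl = contradiction (inj₂ (xRy , yRz)) ¬xy
  ... | inj₂ xRz  = xRz

  trans-strictʳ : ∀ {x y z} → R x y → R y z → ¬ Cl M y z → R x z
  trans-strictʳ xRy yRz ¬yz with wt _ _ _ xRy yRz
  ... | inj₁ refl = contradiction (inj₂ (yRz , xRy)) ¬yz
  ... | inj₂ xRz  = xRz

  □-persists : ∀ {z w χ} → R z w → ¬ Cl M z w → z ⊩ □ χ → w ⊩ □ χ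
  □-persists zRw ¬zw z⊩□χ (v , wRv , v⊮χ) = z⊩□χ (v , trans-strictˡ zRw wRv ¬zw , v⊮χ)

  ⊩-transfer : ∀ {x y} → R x y → R y x → (∀ p → V p x → V p y) → (∀ p → V p y → V p x) →
               ∀ φ → x ⊩ φ → y ⊩ φ
  ⊩-transfer xRy yRx x⇒y y⇒x (var p)  = x⇒y p
  ⊩-transfer xRy yRx x⇒y y⇒x ⊥'       = id
  ⊩-transfer xRy yRx x⇒y y⇒x ⊤'       = id
  ⊩-transfer xRy yRx x⇒y y⇒x (φ ∧' ψ) (x⊩φ , x⊩ψ) =
    ⊩-transfer xRy yRx x⇒y y⇒x φ x⊩φ , ⊩-transfer xRy yRx x⇒y y⇒x ψ x⊩ψ
  ⊩-transfer xRy yRx x⇒y y⇒x (¬' φ)   x⊮φ y⊩φ = x⊮φ (⊩-transfer yRx xRy y⇒x x⇒y φ y⊩φ)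
  ⊩-transfer {x} xRy yRx x⇒y y⇒x (◇ φ) (z , xRz , z⊩φ) with wt _ _ _ yRx xRz
  ... | inj₁ refl = x , yRx , ⊩-transfer yRx xRy y⇒x x⇒y φ z⊩φ
  ... | inj₂ yRz  = z , yRz , z⊩φ

module DescriptiveModel (lem : ∀ {ℓ} → ExcludedMiddle ℓ) {n : ℕ} (M : Model n)
                        (wt : WeaklyTransitive M) (D : Descriptive M) where
  open Model M
  open Descriptive D
  open WeaklyTransitiveModel M wt

  □-elim : ∀ {x y χ} → x ⊩ □ χ → R x y → y ⊩ χ
  □-elim {y = y} x⊩□χ xRy = em⇒dne lem λ y⊮χ → x⊩□χ (y , xRy , y⊮χ)

  R-intro : ∀ {x y} → (∀ χ → x ⊩ □ χ → y ⊩ χ) → R x y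
  R-intro {x} {y} □⇒ = Equivalence.from (ref₂ x y) λ χ (_ , x⊩□χ) → Over-⊤ χ , □⇒ χ x⊩□χ

  types-≐ : ∀ {ϱ a b} → TrueSet M (t M ϱ a) b → t M ϱ a ≐ t M ϱ b
  types-≐ b⊩ =
    (λ {φ} (o , a⊩φ) → o , b⊩ φ (o , a⊩φ)) ,
    (λ {φ} (o , b⊩φ) → o , em⇒dne lem λ a⊮φ → b⊩ (¬' φ) (o , a⊮φ) b⊩φ)

  ◇-compactness : (Γ : Pred (Formula n) 0ℓ) (x : W) →
    (∀ Γ′ → FiniteSubset M Γ Γ′ → x ⊩ ◇ ⋀ Γ′) → ∃[ y ] R x y × TrueSet M Γ y
  ◇-compactness Γ x ◇Γ =
    let y , y⊩ = com (Γ ∪ λ φ → x ⊩ □ φ) finitely-satisfiable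
    in y , R-intro (λ χ x⊩□χ → y⊩ χ (inj₂ x⊩□χ)) , λ φ γ → y⊩ φ (inj₁ γ)
    where
    finitely-satisfiable : ∀ Δ → All (Γ ∪ λ φ → x ⊩ □ φ) Δ → ∃[ z ] ∀ φ → φ ∈ Δ → z ⊩ φ
    finitely-satisfiable Δ ps =
      let Δ₁ , γs , split = partition-All ps
          z , xRz , z⊩Δ₁ = ◇Γ Δ₁ γs
      in z , λ φ φ∈Δ →
           [ All.lookup (⋀-All Δ₁ z⊩Δ₁) , (λ x⊩□φ → □-elim {χ = φ} x⊩□φ xRz) ] (split φ∈Δ)

  forth : ∀ {ϱ a b a′} → t M ϱ a ≐ t M ϱ b → R a a′ → ∃[ b′ ] R b b′ × t M ϱ a′ ≐ t M ϱ b′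
  forth {ϱ} {b = b} {a′} a≐b aRa′ =
    let b′ , bRb′ , b′⊩ = ◇-compactness (t M ϱ a′) b ◇-types
    in b′ , bRb′ , types-≐ b′⊩
    where
    ◇-types : ∀ Δ → All (t M ϱ a′) Δ → b ⊩ ◇ ⋀ Δ
    ◇-types Δ ts =
      let os , ss = All.unzip ts
      in proj₂ (proj₁ a≐b {◇ ⋀ Δ} (Over-⋀ os , a′ , aRa′ , All-⋀ ss))

  atoms : W → Fin n → Fin 2
  atoms x p = bit (lem {P = V p x})

  atoms-injective-on-cluster : ∀ {x y} → Cl M x y → atoms x ≗ atoms y → x ≡ y
  atoms-injective-on-cluster (inj₁ x≡y) _ = x≡y
  atoms-injective-on-cluster {x} {y} (inj₂ (xRy , yRx)) same =
    Equivalence.from (dif x y)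
      ( (λ {φ} (o , x⊩φ) → o , ⊩-transfer xRy yRx x⇒y y⇒x φ x⊩φ)
      , (λ {φ} (o , y⊩φ) → o , ⊩-transfer yRx xRy y⇒x x⇒y φ y⊩φ))
    where
    x⇒y : ∀ p → V p x → V p y
    x⇒y p = bit-≡⇒ _ _ (same p)
    y⇒x : ∀ p → V p y → V p x
    y⇒x p = bit-≡⇒ _ _ (sym (same p))

  cluster-card : ∀ c → CardBound M c
  cluster-card c =
    funToFin ∘ atoms ∘ proj₁ ,
    λ {(_ , cx)} {(_ , cy)} eq →
      atoms-injective-on-cluster (Cl-euclidean cx cy) (funToFin-injective eq)

  LocallyMaximal : Subset n → W → Set
  LocallyMaximal ϱ z = ∀ w → R z w → t M ϱ z ≐ t M ϱ w → Cl M z w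

  locallyMaximal⇒maximal : ∀ {ϱ z} → LocallyMaximal ϱ z → Maximal M ϱ z
  locallyMaximal⇒maximal z-max u y zu (v , zv , vRy) u≐y with R-from-cluster zv vRy
  ... | inj₁ zy = zy
  ... | inj₂ zRy with zu
  ...   | inj₁ refl        = z-max y zRy u≐y
  ...   | inj₂ (_ , uRz) =
    let w , yRw , z≐w = forth u≐y uRz
    in Cl-between zRy yRw (λ zRw → z-max w zRw z≐w)

  locallyMaximal⇒types-⊆ : ∀ {ϱ c z} → t M ϱ c ≐ t M ϱ z → LocallyMaximal ϱ z → TypesIncl M ϱ c z
  locallyMaximal⇒types-⊆ c≐z z-max u (inj₁ refl) = _ , inj₁ refl , c≐z
  locallyMaximal⇒types-⊆ c≐z z-max u (inj₂ (cRu , uRc)) =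
    let w , zRw , u≐w = forth c≐z cRu
        w′ , wRw′ , c≐w′ = forth u≐w uRc
    in w , Cl-between zRw wRw′ (λ zRw′ → z-max w′ zRw′ (≐-trans (≐-sym c≐z) c≐w′)) , u≐w

  ≡⊎R⇒ClRr : ∀ {c z} → c ≡ z ⊎ R c z → ClRr M c z
  ≡⊎R⇒ClRr (inj₁ refl) = inj₁ ≐-refl
  ≡⊎R⇒ClRr {c} {z} (inj₂ cRz) with lem {P = SameCluster M c z}
  ... | yes same  = inj₁ same
  ... | no ¬same = inj₂ ((c , z , inj₁ refl , inj₁ refl , cRz) , ¬same)

  module ClusterAbove (ϱ : Subset n) (c : W) where

    Twin : W → Set
    Twin z = R c z × t M ϱ c ≐ t M ϱ z

    BoxesAtTwin : List (Formula n) → Set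
    BoxesAtTwin Δ = ∃[ z ] Twin z × (∀ {χ} → χ ∈ Δ → z ⊩ □ χ)

    open Lindenbaum lem BoxesAtTwin formulas

    Boxes : Pred (Formula n) 0ℓ → Pred (Formula n) 0ℓ
    Boxes S φ = ∃[ χ ] φ ≡ □ χ × S χ

    Base : Pred (Formula n) 0ℓ
    Base = t M ϱ c ∪ λ φ → c ⊩ □ φ

    Φ : Pred (Formula n) 0ℓ
    Φ = Base ∪ Boxes Limit

    Φ-stage : ℕ → Pred (Formula n) 0ℓ
    Φ-stage k = Base ∪ Boxes (_∈ stage k)

    Φ-stage-increasing : Increasing Φ-stage
    Φ-stage-increasing k (inj₁ b)              = inj₁ b
    Φ-stage-increasing k (inj₂ (χ , eq , χ∈)) = inj₂ (χ , eq , stage-increasing k χ∈)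

    Φ⇒Φ-stage : ∀ {φ} → Φ φ → ∃[ k ] Φ-stage k φ
    Φ⇒Φ-stage (inj₁ b)                  = 0 , inj₁ b
    Φ⇒Φ-stage (inj₂ (χ , eq , k , χ∈)) = k , inj₂ (χ , eq , χ∈)

    Φ-stage-satisfiable : ∀ {k} → BoxesAtTwin (stage k) → ∃[ z ] TrueSet M (Φ-stage k) z
    Φ-stage-satisfiable {k} (z , (cRz , c≐z) , z⊩□) = z , z⊩
      where
      z⊩ : TrueSet M (Φ-stage k) z
      z⊩ φ (inj₁ (inj₁ tφ))       = proj₂ (proj₁ c≐z {φ} tφ)
      z⊩ φ (inj₁ (inj₂ c⊩□φ))     = □-elim {χ = φ} c⊩□φ cRz
      z⊩ φ (inj₂ (χ , refl , χ∈)) = z⊩□ χ∈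

    Φ-finitely-satisfiable : BoxesAtTwin [] → ∀ Δ → All Φ Δ → ∃[ z ] ∀ φ → φ ∈ Δ → z ⊩ φ
    Φ-finitely-satisfiable twin Δ ps =
      let K , ps′ = All-bounded Φ-stage-increasing (All.map Φ⇒Φ-stage ps)
          z , z⊩ = Φ-stage-satisfiable {K} (stage-P twin K)
      in z , λ φ φ∈Δ → z⊩ φ (All.lookup ps′ φ∈Δ)

    Candidate : W → Set
    Candidate = TrueSet M Φ

    candidate-twin : ∀ {y} → Candidate y → Twin y
    candidate-twin y⊩ =
      R-intro (λ χ c⊩□χ → y⊩ χ (inj₁ (inj₂ c⊩□χ))) , types-≐ (λ φ tφ → y⊩ φ (inj₁ (inj₁ tφ)))

    candidate-□-theory : ∀ {y χ} → Candidate y → y ⊩ □ χ → Limit χ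
    candidate-□-theory {y} y⊩ y⊩□χ =
      Limit-maximal formulas-complete _ λ Δ Δ⊆ →
        y , candidate-twin y⊩ , λ { (here refl) → y⊩□χ
                                  ; (there ψ∈) → y⊩ _ (inj₂ (_ , refl , Δ⊆ ψ∈)) }

    candidate-R : ∀ {z w y} → Candidate z → Candidate w → R z y → R w y
    candidate-R z⊩ w⊩ zRy =
      R-intro λ χ w⊩□χ → □-elim {χ = χ} (z⊩ (□ χ) (inj₂ (χ , refl , candidate-□-theory w⊩ w⊩□χ))) zRy

    candidate-step : ∀ {y w} → Candidate y → R y w → t M ϱ y ≐ t M ϱ w → ¬ Cl M y w → Candidate w
    candidate-step y⊩ yRw y≐w ¬yw φ (inj₁ (inj₁ tφ)) =
      proj₂ (proj₁ (≐-trans (proj₂ (candidate-twin y⊩)) y≐w) {φ} tφ)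
    candidate-step y⊩ yRw y≐w ¬yw φ (inj₁ (inj₂ c⊩□φ)) =
      □-elim {χ = φ} c⊩□φ (trans-strictʳ (proj₁ (candidate-twin y⊩)) yRw ¬yw)
    candidate-step y⊩ yRw y≐w ¬yw _ (inj₂ (χ , refl , lim)) =
      □-persists {χ = χ} yRw ¬yw (y⊩ (□ χ) (inj₂ (χ , refl , lim)))

    MaximalAbove : W → Set
    MaximalAbove z = (c ≡ z ⊎ R c z) × t M ϱ c ≐ t M ϱ z × LocallyMaximal ϱ z

    candidate-maximalAbove : ∀ {y} → Candidate y → (∀ {w} → Candidate w → R y w → R w y) →
                             MaximalAbove y
    candidate-maximalAbove y⊩ back =
      let cRy , c≐y = candidate-twin y⊩
      in inj₂ cRy , c≐y , λ w yRw y≐w →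
           em⇒dne lem λ ¬yw → ¬yw (inj₂ (yRw , back (candidate-step y⊩ yRw y≐w ¬yw) yRw))

    maximalAbove : ∃ MaximalAbove
    maximalAbove with lem {P = ∃ Twin}
    ... | no ¬twin = c , inj₁ refl , ≐-refl , λ w cRw c≐w → ⊥-elim (¬twin (w , cRw , c≐w))
    ... | yes (z , twin) with com Φ (Φ-finitely-satisfiable (z , twin , λ ()))
    ...   | z₀ , z₀⊩ with lem {P = ∃[ y ] Candidate y × R z₀ y}
    ...     | yes (y , y⊩ , z₀Ry) = y , candidate-maximalAbove y⊩ (λ w⊩ _ → candidate-R z₀⊩ w⊩ z₀Ry)
    ...     | no ¬y = z₀ , candidate-maximalAbove z₀⊩ (λ w⊩ z₀Rw → ⊥-elim (¬y (_ , w⊩ , z₀Rw)))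

  maximal-cluster-above : ∀ ϱ c → ∃ λ c′ → Maximal M ϱ c′ × ClRr M c c′ × TypesIncl M ϱ c c′
  maximal-cluster-above ϱ c =
    let z , c⊑z , c≐z , z-max = ClusterAbove.maximalAbove ϱ c
    in z , locallyMaximal⇒maximal z-max , ≡⊎R⇒ClRr c⊑z , locallyMaximal⇒types-⊆ c≐z z-max

lemma2p1 : (lem : ∀ {ℓ : Level} → ExcludedMiddle ℓ) →
    ∀ {n : ℕ} (M : Model n) → WeaklyTransitive M → Descriptive M →
    (ϱ : Subset n) (c : Model.W M) (Γ : Pred (Formula n) _) →
      CardBound M c
      × (∀ (x : Model.W M) →
           (∀ (Γ′ : List (Formula n)) → FiniteSubset M Γ Γ′ → _⊨_ M x (◇ ⋀ Γ′)) →
           ∃ λ y → Model.R M x y × TrueSet M Γ y)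
      × (∃ λ c′ → Maximal M ϱ c′ × ClRr M c c′ × TypesIncl M ϱ c c′)
lemma2p1 lem M wt D ϱ c Γ = cluster-card c , ◇-compactness Γ , maximal-cluster-above ϱ c
  where open DescriptiveModel lem M wt D
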